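{- Let $D\ge2$ be squarefree, $K=\mathbb{Q}(\sqrt D)$ with discriminant $\Delta$, and let $\alpha_i$, $N_i$, $\gamma_i$ be as in the context. For all $m,n\in\mathbb{Z}$ and all odd $i\ge-1$, \[N(m\alpha_i+n\alpha_{i+1})=\Bigl(m-\frac{n}{\gamma_{i+2}}\Bigr)\Bigl(n\sqrt\Delta+mN_i-n\frac{N_i}{\gamma_{i+2}}\Bigr).\]
   Context: $D\ge2$ is squarefree, $K=\mathbb{Q}(\sqrt D)$, $x'$ the Galois conjugate, $N(x)=xx'$ the norm. $\Delta=4D$ if $D\equiv2,3\pmod4$ and $\Delta=D$ if $D\equiv1\pmod4$. Let $\omega_D=\sqrt D$ if $D\equiv 2,3\pmod 4$ and $\omega_D=\frac{1+\sqrt D}{2}$ if $D\equiv1\pmod4$. Let $\sigma_D=\omega_D+\lfloor-\omega_D'\rfloor=[\overline{u_0,\dots,u_{s-1}}]$ (purely periodic continued fraction, positive integers $u_i$), extended by $u_{i+s}=u_i$. Define $p_{ -1}=1,q_{ -1}=0,p_0=\lceil u_0/2\rceil,q_0=1$, $X_{i+2}=u_{i+2}X_{i+1}+X_i$ ($i\ge-1$, $X\in\{p,q\}$), $\alpha_i=p_i-q_i\omega_D'$, and $N_i=|N(\alpha_i)|$. For $i\ge1$, $\gamma_i=[u_i,u_{i+1},u_{i+2},\dots]$ (infinite continued fraction). -}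

module Defs where

open import Data.Bool using (Bool; if_then_else_)
open import Data.Nat as ℕ using (ℕ; zero; suc; _%_)
import Data.Nat.DivMod
open import Data.Nat.Divisibility using (_∣_)
open import Data.Integer as ℤ using (ℤ; +_)
open import Data.Rational as ℚ using (ℚ; 0ℚ; 1ℚ)
import Data.Rational.Properties as ℚP
open import Data.Product using (_×_; _,_)
open import Data.Sum using (_⊎_)
open import Relation.Nullary using (yes; no; ¬_)
open import Relation.Binary.PropositionalEquality using (_≡_; _≢_)

SquareFree : ℕ → Set
SquareFree D = ∀ p → (p ℕ.* p) ∣ D → p ≡ 1

isOneMod4 : ℕ → Bool
isOneMod4 D = (D % 4) ℕ.≡ᵇ 1

-- Elements of K = ℚ(√D), written re + im·√D  (√D the positive real root)
record K : Set where
  constructor _+_√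
  field
    re : ℚ
    im : ℚ
open K public

ι : ℚ → K
ι a = a + 0ℚ √

ιℤ : ℤ → K
ιℤ z = ι (z ℚ./ 1)

ιℕ : ℕ → K
ιℕ n = ιℤ (+ n)

_⊕_ : K → K → K
(a + b √) ⊕ (c + d √) = (a ℚ.+ c) + (b ℚ.+ d) √

⊖_ : K → K
⊖ (a + b √) = (ℚ.- a) + (ℚ.- b) √

_⊝_ : K → K → K
x ⊝ y = x ⊕ (⊖ y)

mulK : ℕ → K → K → K
mulK D (a + b √) (c + d √) =
  ((a ℚ.* c) ℚ.+ ((+ D ℚ./ 1) ℚ.* (b ℚ.* d))) + ((a ℚ.* d) ℚ.+ (b ℚ.* c)) √

conj : K → K
conj (a + b √) = a + (ℚ.- b) √

normK : ℕ → K → ℚ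
normK D (a + b √) = (a ℚ.* a) ℚ.- ((+ D ℚ./ 1) ℚ.* (b ℚ.* b))

-- rational reciprocal, total (1/0 := 0; never used at 0 below)
recipℚ : ℚ → ℚ
recipℚ q with q ℚP.≟ 0ℚ
... | yes _ = 0ℚ
... | no q≢0 = ℚ.1/_ q {{ℚ.≢-nonZero q≢0}}

invK : ℕ → K → K
invK D x = mulK D (conj x) (ι (recipℚ (normK D x)))

-- order on K via the real embedding with √D > 0:
-- a + b√D ≥ 0
NonNeg : ℕ → K → Set
NonNeg D (a + b √) =
    (0ℚ ℚ.≤ a × 0ℚ ℚ.≤ b)
  ⊎ (0ℚ ℚ.≤ a × b ℚ.< 0ℚ × ((+ D ℚ./ 1) ℚ.* (b ℚ.* b)) ℚ.≤ (a ℚ.* a))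
  ⊎ (a ℚ.< 0ℚ × 0ℚ ℚ.≤ b × (a ℚ.* a) ℚ.≤ ((+ D ℚ./ 1) ℚ.* (b ℚ.* b)))

LeK : ℕ → K → K → Set
LeK D x y = NonNeg D (y ⊝ x)

LtK : ℕ → K → K → Set
LtK D x y = LeK D x y × x ≢ y

IsFloor : ℕ → ℤ → K → Set
IsFloor D z x = LeK D (ιℤ z) x × LtK D x (ιℤ (z ℤ.+ + 1))

half : ℚ
half = + 1 ℚ./ 2

ω : ℕ → K
ω D = if isOneMod4 D then (half + half √) else (0ℚ + 1ℚ √)

-- √Δ  (Δ = D if D ≡ 1 mod 4, else 4D)
sqrtΔ : ℕ → K
sqrtΔ D = if isOneMod4 D then (0ℚ + 1ℚ √) else (0ℚ + (+ 2 ℚ./ 1) √)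

-- σ_D = ω_D + ⌊-ω_D'⌋, given f = ⌊-ω_D'⌋
σ : ℕ → ℤ → K
σ D f = ω D ⊕ ιℤ f

-- Shifted convergent numerators/denominators: pS j = p_{j-1}, qS j = q_{j-1}
pS : (ℕ → ℕ) → ℕ → ℤ
pS u zero = + 1
pS u (suc zero) = + ((u 0 ℕ.+ 1) Data.Nat.DivMod./ 2)
pS u (suc (suc j)) = (+ u (suc j)) ℤ.* pS u (suc j) ℤ.+ pS u j

qS : (ℕ → ℕ) → ℕ → ℤ
qS u zero = + 0
qS u (suc zero) = + 1
qS u (suc (suc j)) = (+ u (suc j)) ℤ.* qS u (suc j) ℤ.+ qS u j

-- αS j = α_{j-1} = p_{j-1} - q_{j-1} ω_D'
αS : ℕ → (ℕ → ℕ) → ℕ → K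
αS D u j = ιℤ (pS u j) ⊝ mulK D (ιℤ (qS u j)) (conj (ω D))

-- NS j = N_{j-1} = |N(α_{j-1})|
NS : ℕ → (ℕ → ℕ) → ℕ → ℚ
NS D u j = ℚ.∣ normK D (αS D u j) ∣

-- Put z_k = γ_k − u_k, so that γ_{k+1} = z_k⁻¹.  The heart of the proof is
-- the relation α_k = −z_k′ α_{k−1}, proved by induction from the convergent recursion;
-- its base case is p₀ = ⌈u₀/2⌉ = u₀ − f, i.e. u₀ = 2f + t_D (t_D the trace of ω_D),
-- which follows from the two floor conditions because √D is irrational.  With
-- A = α_i, B = α_{i+1} = −z′A and 1/γ_{i+2} = z, the claimed formula is a polynomial
-- identity in the commutative ring K = ℚ(√D), provided A′B − AB′ = √Δ and N_i = N(A).
-- The first holds since this "cross" term changes sign at each step and starts at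
-- ω − ω′ = √Δ; the second since N(α_k) = N(z_k) N(α_{k−1}) with N(z_k) < 0, every γ_k
-- having negative conjugate, so N(α_i) > 0 for odd i.
module Submission where

open import Defs
open import Data.Nat as ℕ using (ℕ; zero; suc)
open import Data.Integer as ℤ using (ℤ; +_; -[1+_])
open import Data.Rational as ℚ using (ℚ; 0ℚ; 1ℚ; mkℚ; _+_; _*_; _-_; -_; _<_; _≤_)
import Data.Integer.Properties as ℤP
import Data.Rational.Properties as ℚP
import Data.Nat.Coprimality as Cop
import Data.Nat.Properties as ℕP
import Data.Nat.DivMod as ℕD
import Data.Nat.Tactic.RingSolver as NS
import Data.Integer.Tactic.RingSolver as ZS
open import Data.Nat.Divisibility using (divides; ∣-refl)
import Data.Rational.Unnormalised as ℚᵘ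
import Data.Rational.Unnormalised.Properties as ℚᵘP
open import Data.Maybe using (Maybe; map)
open import Data.Product using (_×_; _,_; proj₁; proj₂)
open import Data.Sum using (_⊎_; inj₁; inj₂)
open import Relation.Binary.Definitions using (tri<; tri≈; tri>)
open import Relation.Binary.PropositionalEquality
open import Relation.Nullary.Decidable using (dec⇒maybe; yes; no)
open import Data.Empty using (⊥; ⊥-elim)
open import Level using (0ℓ)
open import Data.Bool using (true; false; if_then_else_)
open import Algebra.Bundles using (CommutativeRing)
open import Algebra.Structures using (IsCommutativeRing)
import Algebra.Solver.Ring
import Algebra.Solver.Ring.AlmostCommutativeRing as SolverACR
import Tactic.RingSolver.Core.AlmostCommutativeRing as ACR
open import Tactic.RingSolver using (solve-∀)

ℚ-ring : ACR.AlmostCommutativeRing 0ℓ 0ℓ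
ℚ-ring = ACR.fromCommutativeRing ℚP.+-*-commutativeRing isZero
  where
  isZero : ∀ q → Maybe (0ℚ ≡ q)
  isZero q = map sym (dec⇒maybe (q ℚP.≟ 0ℚ))


neg-neg : ∀ a → - - a ≡ a
neg-neg = solve-∀ ℚ-ring

neg-sq : ∀ a → - a * - a ≡ a * a
neg-sq = solve-∀ ℚ-ring

<⇒sub<0 : ∀ {a b} → a < b → a - b < 0ℚ
<⇒sub<0 {a} {b} a<b = subst (a - b <_) (ℚP.+-inverseʳ b) (ℚP.+-monoˡ-< (- b) a<b)

sub<0⇒< : ∀ {a b} → a - b < 0ℚ → a < b
sub<0⇒< {a} {b} lt = subst₂ _<_ (cancel a b) (ℚP.+-identityˡ b) (ℚP.+-monoˡ-< b lt)
  where
  cancel : ∀ a b → a - b + b ≡ a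
  cancel = solve-∀ ℚ-ring

neg<⇒0<+ : ∀ {a b} → - a < b → 0ℚ < a + b
neg<⇒0<+ {a} {b} lt = subst (_< a + b) (ℚP.+-inverseʳ a) (ℚP.+-monoʳ-< a lt)

sq-mono : ∀ {a b} → 0ℚ ≤ a → a ≤ b → a * a ≤ b * b
sq-mono {a} {b} 0≤a a≤b =
  ℚP.≤-trans (ℚP.*-monoˡ-≤-nonNeg a {{ℚ.nonNegative 0≤a}} a≤b)
             (ℚP.*-monoʳ-≤-nonNeg b {{ℚ.nonNegative (ℚP.≤-trans 0≤a a≤b)}} a≤b)

≤∧≢⇒< : ∀ {a b} → a ≤ b → a ≢ b → a < b
≤∧≢⇒< {a} {b} a≤b a≢b with ℚP.<-cmp a b
... | tri< a<b _ _ = a<b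
... | tri≈ _ a≡b _ = ⊥-elim (a≢b a≡b)
... | tri> _ _ b<a = ⊥-elim (ℚP.<-irrefl refl (ℚP.<-≤-trans b<a a≤b))

+≡0⇒≡neg : ∀ {a b} → a + b ≡ 0ℚ → b ≡ - a
+≡0⇒≡neg {a} {b} a+b≡0 = trans (isolate a b) (trans (cong (_- a) a+b≡0) (ℚP.+-identityˡ (- a)))
  where
  isolate : ∀ a b → b ≡ (a + b) - a
  isolate = solve-∀ ℚ-ring

neg*pos<0 : ∀ {a b} → a < 0ℚ → 0ℚ < b → a * b < 0ℚ
neg*pos<0 {a} {b} a<0 0<b = ℚP.negative⁻¹ _ {{ℚP.neg*pos⇒neg a {{ℚ.negative a<0}} b {{ℚ.positive 0<b}}}}

neg*neg>0 : ∀ {a b} → a < 0ℚ → b < 0ℚ → 0ℚ < a * b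
neg*neg>0 {a} {b} a<0 b<0 = ℚP.positive⁻¹ _ {{ℚP.neg*neg⇒pos a {{ℚ.negative a<0}} b {{ℚ.negative b<0}}}}

sq-lt : ∀ {a b} → 0ℚ ≤ b → a * a < b * b → a < b
sq-lt {a} {b} 0≤b lt with ℚP.<-cmp a b
... | tri< a<b _ _ = a<b
... | tri≈ _ a≡b _ = ⊥-elim (ℚP.<-irrefl (cong (λ c → c * c) a≡b) lt)
... | tri> _ _ b<a = ⊥-elim (ℚP.<-irrefl refl (ℚP.<-≤-trans lt (sq-mono 0≤b (ℚP.<⇒≤ b<a))))

sq-pos : ∀ a → a ≢ 0ℚ → 0ℚ < a * a
sq-pos a a≢0 with ℚP.<-cmp a 0ℚ
... | tri< a<0 _ _ = ℚP.positive⁻¹ _ {{ℚP.neg*neg⇒pos a {{ℚ.negative a<0}} a {{ℚ.negative a<0}}}}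
... | tri≈ _ a≡0 _ = ⊥-elim (a≢0 a≡0)
... | tri> _ _ 0<a = ℚP.positive⁻¹ _ {{ℚP.pos*pos⇒pos a {{ℚ.positive 0<a}} a {{ℚ.positive 0<a}}}}

ℤ→ℚ : ℤ → ℚ
ℤ→ℚ z = z ℚ./ 1

ℤ→ℚ-mkℚ : ∀ z → ℤ→ℚ z ≡ mkℚ z 0 (Cop.sym (Cop.1-coprimeTo _))
ℤ→ℚ-mkℚ (+ n)    = ℚP.normalize-coprime {n} {0} (Cop.sym (Cop.1-coprimeTo _))
ℤ→ℚ-mkℚ -[1+ n ] = cong -_ (ℚP.normalize-coprime {suc n} {0} (Cop.sym (Cop.1-coprimeTo _)))

ℤ→ℚ-+ : ∀ a b → ℤ→ℚ (a ℤ.+ b) ≡ ℤ→ℚ a + ℤ→ℚ b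
ℤ→ℚ-+ a b rewrite ℤ→ℚ-mkℚ a | ℤ→ℚ-mkℚ b =
  cong (ℚ._/ 1) (cong₂ ℤ._+_ (sym (ℤP.*-identityʳ a)) (sym (ℤP.*-identityʳ b)))

ℤ→ℚ-* : ∀ a b → ℤ→ℚ (a ℤ.* b) ≡ ℤ→ℚ a * ℤ→ℚ b
ℤ→ℚ-* a b rewrite ℤ→ℚ-mkℚ a | ℤ→ℚ-mkℚ b = refl

ℤ→ℚ-neg : ∀ a → ℤ→ℚ (ℤ.- a) ≡ - ℤ→ℚ a
ℤ→ℚ-neg (+ zero)  = refl
ℤ→ℚ-neg (+ suc n) = refl
ℤ→ℚ-neg -[1+ n ]  = trans (ℤ→ℚ-mkℚ (+ suc n)) (cong -_ (sym (ℤ→ℚ-mkℚ -[1+ n ])))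

ℤ→ℚ-pos : ∀ a → 0ℚ < ℤ→ℚ a → ℤ.0ℤ ℤ.< a
ℤ→ℚ-pos a lt rewrite ℤ→ℚ-mkℚ a = subst (ℤ.0ℤ ℤ.<_) (ℤP.*-identityʳ a) (ℚP.drop-*<* lt)

K-ext : ∀ {x y : K} → re x ≡ re y → im x ≡ im y → x ≡ y
K-ext refl refl = refl

recip-inverse : ∀ q → q ≢ 0ℚ → recipℚ q * q ≡ 1ℚ
recip-inverse q q≢0 with q ℚP.≟ 0ℚ
... | yes q≡0 = ⊥-elim (q≢0 q≡0)
... | no q≢0′ = ℚP.*-inverseˡ q {{ℚ.≢-nonZero q≢0′}}

recip-involutive : ∀ q → q ≢ 0ℚ → recipℚ (recipℚ q) ≡ q
recip-involutive q q≢0 with q ℚP.≟ 0ℚ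
... | yes q≡0 = ⊥-elim (q≢0 q≡0)
... | no q≢0′ with ℚ.1/_ q {{ℚ.≢-nonZero q≢0′}} ℚP.≟ 0ℚ
...   | yes 1/q≡0 = ⊥-elim (ℚP.1≢0 (trans (sym (ℚP.*-inverseˡ q {{ℚ.≢-nonZero q≢0′}}))
                      (trans (cong (_* q) 1/q≡0) (ℚP.*-zeroˡ q))))
...   | no 1/q≢0 = ℚP.1/-involutive q {{ℚ.≢-nonZero q≢0′}}

recip-neg : ∀ q → q < 0ℚ → recipℚ q < 0ℚ
recip-neg q q<0 with q ℚP.≟ 0ℚ
... | yes q≡0 = ⊥-elim (ℚP.<-irrefl q≡0 q<0)
... | no q≢0 = ℚP.negative⁻¹ _ {{ℚP.1/neg⇒neg q {{ℚ.negative q<0}}}}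

module KArithmetic (D : ℕ) where

  infixl 30 _·_
  _·_ : K → K → K
  x · y = mulK D x y

  0K 1K : K
  0K = ι 0ℚ
  1K = ι 1ℚ

  private
    d : ℚ
    d = + D ℚ./ 1

  ⊕-assoc : ∀ x y z → (x ⊕ y) ⊕ z ≡ x ⊕ (y ⊕ z)
  ⊕-assoc (a + b √) (c + e √) (g + h √) = cong₂ _+_√ (ℚP.+-assoc a c g) (ℚP.+-assoc b e h)

  ⊕-comm : ∀ x y → x ⊕ y ≡ y ⊕ x
  ⊕-comm (a + b √) (c + e √) = cong₂ _+_√ (ℚP.+-comm a c) (ℚP.+-comm b e)

  ⊕-identityˡ : ∀ x → 0K ⊕ x ≡ x
  ⊕-identityˡ (a + b √) = cong₂ _+_√ (ℚP.+-identityˡ a) (ℚP.+-identityˡ b)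

  ⊖-inverseˡ : ∀ x → (⊖ x) ⊕ x ≡ 0K
  ⊖-inverseˡ (a + b √) = cong₂ _+_√ (ℚP.+-inverseˡ a) (ℚP.+-inverseˡ b)

  ·-comm : ∀ x y → x · y ≡ y · x
  ·-comm (a + b √) (c + e √) =
    cong₂ _+_√ (cong₂ _+_ (ℚP.*-comm a c) (cong (d *_) (ℚP.*-comm b e)))
               (trans (ℚP.+-comm (a * e) (b * c)) (cong₂ _+_ (ℚP.*-comm b c) (ℚP.*-comm a e)))

  ·-assoc : ∀ x y z → (x · y) · z ≡ x · (y · z)
  ·-assoc (a + b √) (c + e √) (g + h √) = cong₂ _+_√ (re-part d a b c e g h) (im-part d a b c e g h)
    where
    re-part : ∀ d a b c e g h →
      (a * c + d * (b * e)) * g + d * ((a * e + b * c) * h)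
        ≡ a * (c * g + d * (e * h)) + d * (b * (c * h + e * g))
    re-part = solve-∀ ℚ-ring
    im-part : ∀ d a b c e g h →
      (a * c + d * (b * e)) * h + (a * e + b * c) * g
        ≡ a * (c * h + e * g) + b * (c * g + d * (e * h))
    im-part = solve-∀ ℚ-ring

  ·-identityˡ : ∀ x → 1K · x ≡ x
  ·-identityˡ (a + b √) = cong₂ _+_√ (re-part d a b) (im-part a b)
    where
    re-part : ∀ d a b → 1ℚ * a + d * (0ℚ * b) ≡ a
    re-part = solve-∀ ℚ-ring
    im-part : ∀ a b → 1ℚ * b + 0ℚ * a ≡ b
    im-part = solve-∀ ℚ-ring

  ·-distribˡ : ∀ x y z → x · (y ⊕ z) ≡ x · y ⊕ x · z
  ·-distribˡ (a + b √) (c + e √) (g + h √) = cong₂ _+_√ (re-part d a b c e g h) (im-part a b c e g h)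
    where
    re-part : ∀ d a b c e g h →
      a * (c + g) + d * (b * (e + h)) ≡ (a * c + d * (b * e)) + (a * g + d * (b * h))
    re-part = solve-∀ ℚ-ring
    im-part : ∀ a b c e g h → a * (e + h) + b * (c + g) ≡ (a * e + b * c) + (a * h + b * g)
    im-part = solve-∀ ℚ-ring

  K-isCommutativeRing : IsCommutativeRing _≡_ _⊕_ _·_ ⊖_ 0K 1K
  K-isCommutativeRing = record
    { isRing = record
      { +-isAbelianGroup = record
        { isGroup = record
          { isMonoid = record
            { isSemigroup = record
              { isMagma = record { isEquivalence = isEquivalence ; ∙-cong = cong₂ _⊕_ }
              ; assoc = ⊕-assoc }
            ; identity = ⊕-identityˡ , λ x → trans (⊕-comm x 0K) (⊕-identityˡ x) }
          ; inverse = ⊖-inverseˡ , λ x → trans (⊕-comm x (⊖ x)) (⊖-inverseˡ x)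
          ; ⁻¹-cong = cong ⊖_ }
        ; comm = ⊕-comm }
      ; *-cong = cong₂ _·_
      ; *-assoc = ·-assoc
      ; *-identity = ·-identityˡ , λ x → trans (·-comm x 1K) (·-identityˡ x)
      ; distrib = ·-distribˡ , λ x y z → trans (·-comm (y ⊕ z) x)
                    (trans (·-distribˡ x y z) (cong₂ _⊕_ (·-comm x y) (·-comm x z))) }
    ; *-comm = ·-comm }

  K-commutativeRing : CommutativeRing 0ℓ 0ℓ
  K-commutativeRing = record { isCommutativeRing = K-isCommutativeRing }

  ι-+ : ∀ p q → ι (p + q) ≡ ι p ⊕ ι q
  ι-+ p q = K-ext refl refl

  ι-* : ∀ p q → ι (p * q) ≡ ι p · ι q
  ι-* p q = K-ext (re-part d p q) (im-part p q)
    where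
    re-part : ∀ d p q → p * q ≡ p * q + d * (0ℚ * 0ℚ)
    re-part = solve-∀ ℚ-ring
    im-part : ∀ p q → 0ℚ ≡ p * 0ℚ + 0ℚ * q
    im-part = solve-∀ ℚ-ring

  ι-neg : ∀ p → ι (- p) ≡ ⊖ ι p
  ι-neg p = K-ext refl refl

  ιℤ-+ : ∀ a b → ιℤ (a ℤ.+ b) ≡ ιℤ a ⊕ ιℤ b
  ιℤ-+ a b = trans (cong ι (ℤ→ℚ-+ a b)) (ι-+ (ℤ→ℚ a) (ℤ→ℚ b))

  ιℤ-* : ∀ a b → ιℤ (a ℤ.* b) ≡ ιℤ a · ιℤ b
  ιℤ-* a b = trans (cong ι (ℤ→ℚ-* a b)) (ι-* (ℤ→ℚ a) (ℤ→ℚ b))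

  ιℤ-neg : ∀ a → ιℤ (ℤ.- a) ≡ ⊖ ιℤ a
  ιℤ-neg a = trans (cong ι (ℤ→ℚ-neg a)) (ι-neg (ℤ→ℚ a))

  ιℤ-morphism : ℤ.+-*-rawRing SolverACR.-Raw-AlmostCommutative⟶ SolverACR.fromCommutativeRing K-commutativeRing
  ιℤ-morphism = record
    { ⟦_⟧ = ιℤ ; +-homo = ιℤ-+ ; *-homo = ιℤ-* ; -‿homo = ιℤ-neg ; 0-homo = refl ; 1-homo = refl }

  -- Ring solver for K with integer coefficients: coefficient arithmetic stays
  -- in ℤ, where it computes, even though the multiplication of K mentions D.
  module K-Solver = Algebra.Solver.Ring ℤ.+-*-rawRing (SolverACR.fromCommutativeRing K-commutativeRing)
    ιℤ-morphism (λ a b → map (cong ιℤ) (dec⇒maybe (a ℤ.≟ b)))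

  open K-Solver using (solve; _:=_; _:+_; _:*_; _:-_; :-_)

  conj-⊕ : ∀ x y → conj (x ⊕ y) ≡ conj x ⊕ conj y
  conj-⊕ x y = K-ext refl (ℚP.neg-distrib-+ (im x) (im y))

  conj-· : ∀ x y → conj (x · y) ≡ conj x · conj y
  conj-· (a + b √) (c + e √) = K-ext (re-part d a b c e) (im-part a b c e)
    where
    re-part : ∀ d a b c e → a * c + d * (b * e) ≡ a * c + d * (- b * - e)
    re-part = solve-∀ ℚ-ring
    im-part : ∀ a b c e → - (a * e + b * c) ≡ a * - e + - b * c
    im-part = solve-∀ ℚ-ring

  conj-conj : ∀ x → conj (conj x) ≡ x
  conj-conj x = K-ext refl (neg-neg (im x))

  ι-norm : ∀ x → ι (normK D x) ≡ x · conj x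
  ι-norm (a + b √) = K-ext (re-part d a b) (im-part a b)
    where
    re-part : ∀ d a b → a * a - d * (b * b) ≡ a * a + d * (b * - b)
    re-part = solve-∀ ℚ-ring
    im-part : ∀ a b → 0ℚ ≡ a * - b + b * a
    im-part = solve-∀ ℚ-ring

  ι-injective : ∀ {p q} → ι p ≡ ι q → p ≡ q
  ι-injective = cong re

  norm-· : ∀ x y → normK D (x · y) ≡ normK D x * normK D y
  norm-· x y = ι-injective (begin
    ι (normK D (x · y))                ≡⟨ ι-norm (x · y) ⟩
    (x · y) · conj (x · y)             ≡⟨ cong ((x · y) ·_) (conj-· x y) ⟩
    (x · y) · (conj x · conj y)        ≡⟨ solve 4 (λ x y x′ y′ → (x :* y) :* (x′ :* y′) := (x :* x′) :* (y :* y′))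
                                            refl x y (conj x) (conj y) ⟩
    (x · conj x) · (y · conj y)        ≡⟨ sym (cong₂ _·_ (ι-norm x) (ι-norm y)) ⟩
    ι (normK D x) · ι (normK D y)      ≡⟨ sym (ι-* (normK D x) (normK D y)) ⟩
    ι (normK D x * normK D y)          ∎)
    where open ≡-Reasoning

  norm-ι : ∀ q → normK D (ι q) ≡ q * q
  norm-ι q = helper d q
    where
    helper : ∀ d q → q * q - d * (0ℚ * 0ℚ) ≡ q * q
    helper = solve-∀ ℚ-ring

  norm-conj : ∀ x → normK D (conj x) ≡ normK D x
  norm-conj (a + b √) = cong (λ c → a * a - d * c) (neg-sq b)

  norm-⊖ : ∀ x → normK D (⊖ x) ≡ normK D x
  norm-⊖ (a + b √) = cong₂ _-_ (neg-sq a) (cong (d *_) (neg-sq b))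

  norm-⊖conj· : ∀ x y → normK D (⊖ (conj x · y)) ≡ normK D x * normK D y
  norm-⊖conj· x y = begin
    normK D (⊖ (conj x · y))           ≡⟨ norm-⊖ (conj x · y) ⟩
    normK D (conj x · y)               ≡⟨ norm-· (conj x) y ⟩
    normK D (conj x) * normK D y       ≡⟨ cong (_* normK D y) (norm-conj x) ⟩
    normK D x * normK D y              ∎
    where open ≡-Reasoning

  module _ (x : K) (N≢0 : normK D x ≢ 0ℚ) where
    private
      N R : ℚ
      N = normK D x
      R = recipℚ N

    invK-· : invK D x · x ≡ 1K
    invK-· = begin
      (conj x · ι R) · x    ≡⟨ solve 3 (λ x x′ r → (x′ :* r) :* x := r :* (x :* x′)) refl x (conj x) (ι R) ⟩
      ι R · (x · conj x)    ≡⟨ cong (ι R ·_) (sym (ι-norm x)) ⟩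
      ι R · ι N             ≡⟨ sym (ι-* R N) ⟩
      ι (R * N)             ≡⟨ cong ι (recip-inverse N N≢0) ⟩
      1K                    ∎
      where open ≡-Reasoning

    norm-invK : normK D (invK D x) ≡ R
    norm-invK = begin
      normK D (conj x · ι R)          ≡⟨ norm-· (conj x) (ι R) ⟩
      normK D (conj x) * normK D (ι R) ≡⟨ cong₂ _*_ (norm-conj x) (norm-ι R) ⟩
      N * (R * R)                      ≡⟨ regroup N R ⟩
      (R * N) * R                      ≡⟨ cong (_* R) (recip-inverse N N≢0) ⟩
      1ℚ * R                           ≡⟨ ℚP.*-identityˡ R ⟩
      R                                ∎
      where
      open ≡-Reasoning
      regroup : ∀ N R → N * (R * R) ≡ (R * N) * R
      regroup = solve-∀ ℚ-ring

    invK-involutive : invK D (invK D x) ≡ x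
    invK-involutive = begin
      conj (conj x · ι R) · ι (recipℚ (normK D (invK D x)))
        ≡⟨ cong₂ (λ y q → y · ι (recipℚ q)) conj-inv norm-invK ⟩
      (x · ι R) · ι (recipℚ R)  ≡⟨ cong (λ q → (x · ι R) · ι q) (recip-involutive N N≢0) ⟩
      (x · ι R) · ι N           ≡⟨ ·-assoc x (ι R) (ι N) ⟩
      x · (ι R · ι N)           ≡⟨ cong (x ·_) (sym (ι-* R N)) ⟩
      x · ι (R * N)             ≡⟨ cong (λ q → x · ι q) (recip-inverse N N≢0) ⟩
      x · 1K                    ≡⟨ trans (·-comm x 1K) (·-identityˡ x) ⟩
      x                         ∎
      where
      open ≡-Reasoning
      conj-inv : conj (conj x · ι R) ≡ x · ι R
      conj-inv = trans (conj-· (conj x) (ι R)) (cong (_· ι R) (conj-conj x))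

  invK-coordinates : ∀ x → let R = recipℚ (normK D x) in invK D x ≡ (re x * R) + (- im x * R) √
  invK-coordinates (a + b √) = K-ext (re-part d a b R) (im-part a b R)
    where
    R = recipℚ (normK D (a + b √))
    re-part : ∀ d a b R → a * R + d * (- b * 0ℚ) ≡ a * R
    re-part = solve-∀ ℚ-ring
    im-part : ∀ a b R → a * 0ℚ + - b * R ≡ - b * R
    im-part = solve-∀ ℚ-ring

  ⊖conj-cancel : ∀ x y → normK D x ≢ 0ℚ → ⊖ (conj (invK D x) · (⊖ (conj x · y))) ≡ y
  ⊖conj-cancel x y N≢0 = begin
    ⊖ (conj (invK D x) · (⊖ (conj x · y)))   ≡⟨ solve 3 (λ i x′ y → :- (i :* (:- (x′ :* y))) := (i :* x′) :* y)
                                                  refl (conj (invK D x)) (conj x) y ⟩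
    (conj (invK D x) · conj x) · y          ≡⟨ cong (_· y) (sym (conj-· (invK D x) x)) ⟩
    conj (invK D x · x) · y                 ≡⟨ cong (λ w → conj w · y) (invK-· x N≢0) ⟩
    1K · y                                  ≡⟨ ·-identityˡ y ⟩
    y                                       ∎
    where open ≡-Reasoning

  norm-form : ∀ (m n : ℤ) (A B z h S : K) (N : ℚ) →
    B ≡ ⊖ (conj z · A) → h ≡ z → S ≡ conj A · B ⊝ A · conj B → N ≡ normK D A →
    ι (normK D (ιℤ m · A ⊕ ιℤ n · B))
      ≡ (ιℤ m ⊝ ιℤ n · h) · ((ιℤ n · S ⊕ ιℤ m · ι N) ⊝ ιℤ n · (ι N · h))
  norm-form m n A _ z _ _ _ refl refl refl refl = begin
    ι (normK D (m̂ · A ⊕ n̂ · B))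
      ≡⟨ ι-norm (m̂ · A ⊕ n̂ · B) ⟩
    (m̂ · A ⊕ n̂ · B) · conj (m̂ · A ⊕ n̂ · B)
      ≡⟨ cong ((m̂ · A ⊕ n̂ · B) ·_) conj-combination ⟩
    (m̂ · A ⊕ n̂ · B) · (m̂ · conj A ⊕ n̂ · B′)
      ≡⟨ solve 6 (λ m n A A′ z z′ →
           (m :* A :+ n :* (:- (z′ :* A))) :* (m :* A′ :+ n :* (:- (z :* A′)))
             := (m :- n :* z) :* ((n :* (A′ :* (:- (z′ :* A)) :- A :* (:- (z :* A′))) :+ m :* (A :* A′))
                                   :- n :* ((A :* A′) :* z)))
           refl m̂ n̂ A (conj A) z (conj z) ⟩
    (m̂ ⊝ n̂ · z) · ((n̂ · (conj A · B ⊝ A · B′) ⊕ m̂ · (A · conj A)) ⊝ n̂ · ((A · conj A) · z))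
      ≡⟨ sym (cong₂ (λ b′ Â → (m̂ ⊝ n̂ · z) · ((n̂ · (conj A · B ⊝ A · b′) ⊕ m̂ · Â) ⊝ n̂ · (Â · z)))
                    conj-B (ι-norm A)) ⟩
    (m̂ ⊝ n̂ · z) · ((n̂ · (conj A · B ⊝ A · conj B) ⊕ m̂ · ι (normK D A)) ⊝ n̂ · (ι (normK D A) · z))
      ∎
    where
    open ≡-Reasoning
    m̂ n̂ B B′ : K
    m̂ = ιℤ m
    n̂ = ιℤ n
    B = ⊖ (conj z · A)
    B′ = ⊖ (z · conj A)
    conj-B : conj B ≡ B′
    conj-B = cong ⊖_ (trans (conj-· (conj z) A) (cong (_· conj A) (conj-conj z)))
    conj-combination : conj (m̂ · A ⊕ n̂ · B) ≡ m̂ · conj A ⊕ n̂ · B′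
    conj-combination = trans (conj-⊕ (m̂ · A) (n̂ · B))
                             (cong₂ _⊕_ (conj-· m̂ A) (trans (conj-· n̂ B) (cong (n̂ ·_) conj-B)))

-- Order-theoretic facts; here D ≥ 2 squarefree, so that √D is irrational.
module Order (D : ℕ) (2≤D : 2 ℕ.≤ D) (sf : SquareFree D) where

  d : ℚ
  d = ℤ→ℚ (+ D)

  -- No coprime x, y satisfy x² = D y²: y ∣ x² forces y = 1, and then D = x² forces D = 1.
  no-coprime-root : ∀ x y → Cop.Coprime x y → x ℕ.* x ≡ D ℕ.* (y ℕ.* y) → ⊥
  no-coprime-root x y coprime x²≡Dy² = D≢1 D≡1
    where
    D≢1 : D ≢ 1
    D≢1 D≡1 = ℕP.<⇒≢ 2≤D (sym D≡1)
    y≡1 : y ≡ 1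
    y≡1 = coprime (Cop.coprime-divisor (Cop.sym coprime)
                     (divides (D ℕ.* y) (trans x²≡Dy² (sym (ℕP.*-assoc D y y)))) , ∣-refl)
    x²≡D : x ℕ.* x ≡ D
    x²≡D = trans x²≡Dy² (trans (cong (λ z → D ℕ.* (z ℕ.* z)) y≡1) (ℕP.*-identityʳ D))
    D≡1 : D ≡ 1
    D≡1 = trans (sym x²≡D) (cong (λ z → z ℕ.* z) (sf x (divides 1 (trans (sym x²≡D) (sym (ℕP.*-identityˡ _))))))

  no-rational-root : ∀ r → r * r ≢ d
  no-rational-root r@(mkℚ n den coprime) r²≡d =
    no-coprime-root ℤ.∣ n ∣ (suc den) (Cop.recompute coprime) (sym (begin
      D ℕ.* (suc den ℕ.* suc den)              ≡⟨ ℤP.abs-* (+ D) (+ suc den ℤ.* + suc den) ⟨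
      ℤ.∣ + D ℤ.* (+ suc den ℤ.* + suc den) ∣   ≡⟨ cong ℤ.∣_∣ cross-multiplied ⟩
      ℤ.∣ (n ℤ.* n) ℤ.* + 1 ∣                   ≡⟨ cong ℤ.∣_∣ (ℤP.*-identityʳ (n ℤ.* n)) ⟩
      ℤ.∣ n ℤ.* n ∣                             ≡⟨ ℤP.abs-* n n ⟩
      ℤ.∣ n ∣ ℕ.* ℤ.∣ n ∣                       ∎))
    where
    open ≡-Reasoning
    d≃r² : ℚᵘ.mkℚᵘ (+ D) 0 ℚᵘ.≃ (ℚ.toℚᵘ r ℚᵘ.* ℚ.toℚᵘ r)
    d≃r² = ℚᵘP.≃-trans (ℚᵘP.≃-reflexive (cong ℚ.toℚᵘ (sym (trans r²≡d (ℤ→ℚ-mkℚ (+ D))))))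
                       (ℚP.toℚᵘ-homo-* r r)
    cross-multiplied : + D ℤ.* (+ suc den ℤ.* + suc den) ≡ (n ℤ.* n) ℤ.* + 1
    cross-multiplied with d≃r²
    ... | ℚᵘ.*≡* eq = eq

  irrational : ∀ a b → a * a ≡ d * (b * b) → b ≡ 0ℚ
  irrational a b a²≡db² with b ℚP.≟ 0ℚ
  ... | yes b≡0 = b≡0
  ... | no b≢0 = ⊥-elim (no-rational-root (a * recipℚ b) (begin
    (a * recipℚ b) * (a * recipℚ b)   ≡⟨ regroup a (recipℚ b) ⟩
    (a * a) * (recipℚ b * recipℚ b)   ≡⟨ cong (_* (recipℚ b * recipℚ b)) a²≡db² ⟩
    (d * (b * b)) * (recipℚ b * recipℚ b) ≡⟨ regroup′ d b (recipℚ b) ⟩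
    d * ((recipℚ b * b) * (recipℚ b * b)) ≡⟨ cong (λ q → d * (q * q)) (recip-inverse b b≢0) ⟩
    d * (1ℚ * 1ℚ)                      ≡⟨ ℚP.*-identityʳ d ⟩
    d                                  ∎))
    where
    open ≡-Reasoning
    regroup : ∀ a r → (a * r) * (a * r) ≡ (a * a) * (r * r)
    regroup = solve-∀ ℚ-ring
    regroup′ : ∀ d b r → (d * (b * b)) * (r * r) ≡ d * ((r * b) * (r * b))
    regroup′ = solve-∀ ℚ-ring

  open KArithmetic D using (invK-coordinates)

  d-pos : 0ℚ < d
  d-pos = ℤ→ℚ-pos′ D 2≤D
    where
    ℤ→ℚ-pos′ : ∀ n → 2 ℕ.≤ n → 0ℚ < ℤ→ℚ (+ n)
    ℤ→ℚ-pos′ (suc n) _ = ℚP.positive⁻¹ _ {{ℚP.normalize-pos (suc n) 1}}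

  d-sq-pos : ∀ y → y ≢ 0ℚ → 0ℚ < d * (y * y)
  d-sq-pos y y≢0 = ℚP.positive⁻¹ _
    {{ℚP.pos*pos⇒pos d {{ℚ.positive d-pos}} (y * y) {{ℚ.positive (sq-pos y y≢0)}}}}

  strict-< : ∀ a b → b ≢ 0ℚ → a * a ≤ d * (b * b) → a * a < d * (b * b)
  strict-< a b b≢0 le = ≤∧≢⇒< le (λ eq → b≢0 (irrational a b eq))

  strict-> : ∀ a b → b ≢ 0ℚ → d * (b * b) ≤ a * a → d * (b * b) < a * a
  strict-> a b b≢0 le = ≤∧≢⇒< le (λ eq → b≢0 (irrational a b (sym eq)))

  nonneg-pos-im : ∀ x → 0ℚ < im x → NonNeg D x → 0ℚ ≤ re x ⊎ re x * re x < d * (im x * im x)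
  nonneg-pos-im (a + b √) 0<b (inj₁ (0≤a , _))               = inj₁ 0≤a
  nonneg-pos-im (a + b √) 0<b (inj₂ (inj₁ (_ , b<0 , _)))     = ⊥-elim (ℚP.<-asym 0<b b<0)
  nonneg-pos-im (a + b √) 0<b (inj₂ (inj₂ (_ , _ , a²≤db²))) = inj₂ (strict-< a b (≢-sym (ℚP.<⇒≢ 0<b)) a²≤db²)

  nonneg-neg-im : ∀ x → im x < 0ℚ → NonNeg D x → 0ℚ ≤ re x × d * (im x * im x) < re x * re x
  nonneg-neg-im (a + b √) b<0 (inj₁ (_ , 0≤b))                 = ⊥-elim (ℚP.<-irrefl refl (ℚP.<-≤-trans b<0 0≤b))
  nonneg-neg-im (a + b √) b<0 (inj₂ (inj₁ (0≤a , _ , db²≤a²))) = 0≤a , strict-> a b (ℚP.<⇒≢ b<0) db²≤a²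
  nonneg-neg-im (a + b √) b<0 (inj₂ (inj₂ (_ , 0≤b , _)))       = ⊥-elim (ℚP.<-irrefl refl (ℚP.<-≤-trans b<0 0≤b))

  -- If x, y ≥ 0, im x > 0 and x + y = r is rational, then r > 0: since x is
  -- irrational, neither x nor y can vanish, and no cancellation can occur.
  nonneg-sum-pos : ∀ x y r → 0ℚ < im x → NonNeg D x → NonNeg D y → x ⊕ y ≡ ι r → 0ℚ < r
  nonneg-sum-pos x y r 0<ix x≥0 y≥0 x+y≡r =
    subst (0ℚ <_) (cong re x+y≡r) (sum-pos (nonneg-pos-im x 0<ix x≥0))
    where
    iy≡-ix : im y ≡ - im x
    iy≡-ix = +≡0⇒≡neg (cong im x+y≡r)
    iy<0 : im y < 0ℚ
    iy<0 = subst (_< 0ℚ) (sym iy≡-ix) (ℚP.neg-antimono-< 0<ix)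
    y-bound : 0ℚ ≤ re y × d * (im y * im y) < re y * re y
    y-bound = nonneg-neg-im y iy<0 y≥0
    same-sq : d * (im y * im y) ≡ d * (im x * im x)
    same-sq = cong (λ c → d * c) (trans (cong (λ c → c * c) iy≡-ix) (neg-sq (im x)))
    sum-pos : 0ℚ ≤ re x ⊎ re x * re x < d * (im x * im x) → 0ℚ < re x + re y
    sum-pos (inj₁ 0≤rx) = ℚP.+-mono-≤-< 0≤rx
      (sq-lt {0ℚ} (proj₁ y-bound) (ℚP.<-trans (d-sq-pos (im y) (ℚP.<⇒≢ iy<0)) (proj₂ y-bound)))
    sum-pos (inj₂ rx²<dix²) = neg<⇒0<+ {re x} (sq-lt (proj₁ y-bound)
      (subst (_< re y * re y) (sym (neg-sq (re x)))
        (ℚP.<-trans rx²<dix² (subst (_< re y * re y) same-sq (proj₂ y-bound)))))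

  -- g has positive irrational part and negative conjugate g′ = re g − im g √D.
  ConjNeg : K → Set
  ConjNeg g = 0ℚ < im g × (re g < 0ℚ ⊎ re g * re g < d * (im g * im g))

  -- If im g > 0 and g′ ≤ 0 then g′ < 0, by irrationality.
  conjNeg-intro : ∀ g → 0ℚ < im g → NonNeg D (⊖ conj g) → ConjNeg g
  conjNeg-intro (a + b √) 0<b -g′≥0 = 0<b , conj-neg (nonneg-pos-im (⊖ conj (a + b √)) 0<--b -g′≥0)
    where
    0<--b : 0ℚ < - - b
    0<--b = subst (0ℚ <_) (sym (neg-neg b)) 0<b
    conj-neg : 0ℚ ≤ - a ⊎ - a * - a < d * (- - b * - - b) → a < 0ℚ ⊎ a * a < d * (b * b)
    conj-neg (inj₁ 0≤-a) with ℚP.<-cmp a 0ℚ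
    ... | tri< a<0 _ _ = inj₁ a<0
    ... | tri≈ _ a≡0 _ = inj₂ (subst (λ c → c * c < d * (b * b)) (sym a≡0) (d-sq-pos b (≢-sym (ℚP.<⇒≢ 0<b))))
    ... | tri> _ _ 0<a = ⊥-elim (ℚP.<-irrefl refl (ℚP.<-≤-trans (ℚP.neg-antimono-< 0<a) 0≤-a))
    conj-neg (inj₂ lt) = inj₂ (subst₂ _<_ (neg-sq a) (cong (λ c → d * (c * c)) (neg-neg b)) lt)

  conjNeg-sub : ∀ g q → 0ℚ ≤ q → ConjNeg g → ConjNeg (g ⊝ ι q)
  conjNeg-sub g q 0≤q (0<b , conj-neg) = subst ConjNeg (sym coordinates) (0<b , shifted conj-neg)
    where
    coordinates : g ⊝ ι q ≡ (re g - q) + im g √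
    coordinates = K-ext refl (ℚP.+-identityʳ (im g))
    a-q≤a : re g - q ≤ re g
    a-q≤a = subst (re g - q ≤_) (ℚP.+-identityʳ (re g)) (ℚP.+-monoʳ-≤ (re g) (ℚP.neg-antimono-≤ 0≤q))
    shifted : re g < 0ℚ ⊎ re g * re g < d * (im g * im g)
            → re g - q < 0ℚ ⊎ (re g - q) * (re g - q) < d * (im g * im g)
    shifted (inj₁ a<0) = inj₁ (ℚP.≤-<-trans a-q≤a a<0)
    shifted (inj₂ a²<db²) with re g - q ℚP.<? 0ℚ
    ... | yes a-q<0 = inj₁ a-q<0
    ... | no a-q≮0 = inj₂ (ℚP.≤-<-trans (sq-mono (ℚP.≮⇒≥ a-q≮0) a-q≤a) a²<db²)

  norm-neg : ∀ z → ConjNeg z → NonNeg D z → normK D z < 0ℚ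
  norm-neg z (0<b , conj-neg) z≥0 = <⇒sub<0 (square-bound conj-neg (nonneg-pos-im z 0<b z≥0))
    where
    square-bound : re z < 0ℚ ⊎ re z * re z < d * (im z * im z)
                 → 0ℚ ≤ re z ⊎ re z * re z < d * (im z * im z)
                 → re z * re z < d * (im z * im z)
    square-bound (inj₂ lt) _          = lt
    square-bound (inj₁ _) (inj₂ lt)   = lt
    square-bound (inj₁ a<0) (inj₁ 0≤a) = ⊥-elim (ℚP.<-irrefl refl (ℚP.<-≤-trans a<0 0≤a))

  -- If im z > 0 and N(z) < 0 then z⁻¹ = z′/N(z) has negative conjugate.
  conjNeg-invK : ∀ z → 0ℚ < im z → normK D z < 0ℚ → ConjNeg (invK D z)
  conjNeg-invK z 0<b N<0 = subst ConjNeg (sym (invK-coordinates z)) (im-pos , inj₂ square-bound)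
    where
    R : ℚ
    R = recipℚ (normK D z)
    R<0 : R < 0ℚ
    R<0 = recip-neg (normK D z) N<0
    im-pos : 0ℚ < - im z * R
    im-pos = neg*neg>0 (ℚP.neg-antimono-< 0<b) R<0
    R²-pos : 0ℚ < R * R
    R²-pos = sq-pos R (ℚP.<⇒≢ R<0)
    scale-re : ∀ a R → (a * a) * (R * R) ≡ (a * R) * (a * R)
    scale-re = solve-∀ ℚ-ring
    scale-im : ∀ d b R → (d * (b * b)) * (R * R) ≡ d * ((- b * R) * (- b * R))
    scale-im = solve-∀ ℚ-ring
    square-bound : (re z * R) * (re z * R) < d * ((- im z * R) * (- im z * R))
    square-bound = subst₂ _<_ (scale-re (re z) R) (scale-im d (im z) R)
      (ℚP.*-monoˡ-<-pos (R * R) {{ℚ.positive R²-pos}} (sub<0⇒< {re z * re z} {d * (im z * im z)} N<0))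

trace : ℕ → ℤ
trace D = if isOneMod4 D then + 1 else + 0

ω-trace : ∀ D → ω D ⊕ conj (ω D) ≡ ιℤ (trace D)
ω-trace D with isOneMod4 D
... | true  = refl
... | false = refl

ω-diff : ∀ D → ω D ⊝ conj (ω D) ≡ sqrtΔ D
ω-diff D with isOneMod4 D
... | true  = refl
... | false = refl

ω-im-pos : ∀ D → 0ℚ < im (ω D)
ω-im-pos D with isOneMod4 D
... | true  = ℚP.positive⁻¹ _ {{ℚP.normalize-pos 1 2}}
... | false = ℚP.positive⁻¹ _ {{ℚP.normalize-pos 1 1}}

integer-between : ∀ c → ℤ.0ℤ ℤ.< c ℤ.+ + 1 → ℤ.0ℤ ℤ.< + 1 ℤ.- c → c ≡ + 0
integer-between (+ zero)          _          _          = refl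
integer-between ℤ.+[1+ zero ]     _          (ℤ.+<+ ())
integer-between ℤ.+[1+ suc n ]    _          ()
integer-between -[1+ zero ]       (ℤ.+<+ ()) _
integer-between -[1+ suc n ]      ()         _

ceil-half : ∀ D n f → + n ≡ (f ℤ.+ f) ℤ.+ trace D → + ((n ℕ.+ 1) ℕ./ 2) ≡ + n ℤ.- f
ceil-half D n f n≡2f+t with isOneMod4 D
... | true  = odd n f n≡2f+t
  where
  odd : ∀ n f → + n ≡ (f ℤ.+ f) ℤ.+ + 1 → + ((n ℕ.+ 1) ℕ./ 2) ≡ + n ℤ.- f
  odd n -[1+ k ] ()
  odd n (+ k) n≡2k+1 rewrite ℤP.+-injective n≡2k+1 = begin
    + ((k ℕ.+ k ℕ.+ 1 ℕ.+ 1) ℕ./ 2)  ≡⟨ cong (λ m → + (m ℕ./ 2)) (double k) ⟩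
    + ((k ℕ.+ 1) ℕ.* 2 ℕ./ 2)          ≡⟨ cong +_ (ℕD.m*n/n≡m (k ℕ.+ 1) 2) ⟩
    + k ℤ.+ + 1                         ≡⟨ halve (+ k) ⟩
    (+ k ℤ.+ + k ℤ.+ + 1) ℤ.- + k       ∎
    where
    open ≡-Reasoning
    double : ∀ k → k ℕ.+ k ℕ.+ 1 ℕ.+ 1 ≡ (k ℕ.+ 1) ℕ.* 2
    double = NS.solve-∀
    halve : ∀ x → x ℤ.+ + 1 ≡ (x ℤ.+ x ℤ.+ + 1) ℤ.- x
    halve = ZS.solve-∀
... | false = even n f n≡2f+t
  where
  even : ∀ n f → + n ≡ (f ℤ.+ f) ℤ.+ + 0 → + ((n ℕ.+ 1) ℕ./ 2) ≡ + n ℤ.- f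
  even n -[1+ k ] ()
  even n (+ k) n≡2k rewrite ℤP.+-injective n≡2k = begin
    + ((k ℕ.+ k ℕ.+ 0 ℕ.+ 1) ℕ./ 2)   ≡⟨ cong (λ m → + (m ℕ./ 2)) (double k) ⟩
    + ((k ℕ.* 2 ℕ.+ 1) ℕ./ 2)           ≡⟨ cong +_ (ℕD.+-distrib-/-∣ˡ {k ℕ.* 2} 1 (divides k refl)) ⟩
    + (k ℕ.* 2 ℕ./ 2 ℕ.+ 1 ℕ./ 2)       ≡⟨ cong +_ (trans (ℕP.+-identityʳ _) (ℕD.m*n/n≡m k 2)) ⟩
    + k                                  ≡⟨ halve (+ k) ⟩
    (+ k ℤ.+ + k ℤ.+ + 0) ℤ.- + k        ∎
    where
    open ≡-Reasoning
    halve : ∀ x → x ≡ (x ℤ.+ x ℤ.+ + 0) ℤ.- x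
    halve = ZS.solve-∀
    double : ∀ k → k ℕ.+ k ℕ.+ 0 ℕ.+ 1 ≡ k ℕ.* 2 ℕ.+ 1
    double = NS.solve-∀

module Expansion
  (D : ℕ) (2≤D : 2 ℕ.≤ D) (sf : SquareFree D)
  (f : ℤ) (f-floor : IsFloor D f (⊖ conj (ω D)))
  (u : ℕ → ℕ) (γ : ℕ → K) (γ₀ : γ 0 ≡ σ D f)
  (u-floor : ∀ k → IsFloor D (+ u k) (γ k))
  (γ-suc : ∀ k → γ (suc k) ≡ invK D (γ k ⊝ ιℕ (u k))) where

  open KArithmetic D
  open K-Solver using (solve; _:=_; _:+_; _:*_; _:-_; :-_; con)
  open Order D 2≤D sf

  z : ℕ → K
  z k = γ k ⊝ ιℕ (u k)

  -- α j is the paper's α_{j−1}.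
  α : ℕ → K
  α = αS D u

  private
    0≤u : ∀ k → 0ℚ ≤ ℤ→ℚ (+ u k)
    0≤u k = ℚP.nonNegative⁻¹ _ {{ℚP.normalize-nonNeg (u k) 1}}

  -- Every γ_k has negative conjugate (γ_k is "reduced"); hence so has z_k,
  -- whose norm is then negative.
  z-conjNeg′ : ∀ k → ConjNeg (γ k) → ConjNeg (z k)
  z-conjNeg′ k = conjNeg-sub (γ k) (ℤ→ℚ (+ u k)) (0≤u k)

  norm-z-neg′ : ∀ k → ConjNeg (γ k) → normK D (z k) < 0ℚ
  norm-z-neg′ k γ-neg = norm-neg (z k) (z-conjNeg′ k γ-neg) (proj₁ (u-floor k))

  γ-conjNeg : ∀ k → ConjNeg (γ k)
  γ-conjNeg zero = subst ConjNeg (sym γ₀) (conjNeg-intro (ω D ⊕ ιℤ f) im-pos conj-nonpos)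
    where
    im-pos : 0ℚ < im (ω D) + 0ℚ
    im-pos = subst (0ℚ <_) (sym (ℚP.+-identityʳ (im (ω D)))) (ω-im-pos D)
    conj-nonpos : NonNeg D (⊖ conj (ω D ⊕ ιℤ f))
    conj-nonpos = subst (NonNeg D)
      (trans (solve 2 (λ w′ F → :- w′ :- F := :- (w′ :+ F)) refl (conj (ω D)) (ιℤ f))
             (cong ⊖_ (sym (conj-⊕ (ω D) (ιℤ f)))))
      (proj₁ f-floor)
  γ-conjNeg (suc k) = subst ConjNeg (sym (γ-suc k))
    (conjNeg-invK (z k) (proj₁ (z-conjNeg′ k (γ-conjNeg k))) (norm-z-neg′ k (γ-conjNeg k)))

  z-conjNeg : ∀ k → ConjNeg (z k)
  z-conjNeg k = z-conjNeg′ k (γ-conjNeg k)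

  norm-z-neg : ∀ k → normK D (z k) < 0ℚ
  norm-z-neg k = norm-z-neg′ k (γ-conjNeg k)

  norm-z≢0 : ∀ k → normK D (z k) ≢ 0ℚ
  norm-z≢0 k = ℚP.<⇒≢ (norm-z-neg k)

  -- With c = 2f + t_D − u₀, the elements γ₀ − u₀ ≥ 0 and
  -- (f + 1) + ω′ ≥ 0 sum to c + 1, while −ω′ − f ≥ 0 and (u₀ + 1) − γ₀ ≥ 0
  -- sum to 1 − c; both sums are thus positive, so c = 0.
  u₀-eq : + u 0 ≡ (f ℤ.+ f) ℤ.+ trace D
  u₀-eq = sym (ℤP.i-j≡0⇒i≡j _ _ (integer-between c
    (ℤ→ℚ-pos (c ℤ.+ + 1) (nonneg-sum-pos (z 0) _ _ (proj₁ (z-conjNeg 0))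
      (proj₁ (u-floor 0)) (proj₁ (proj₂ f-floor)) sum₁))
    (ℤ→ℚ-pos (+ 1 ℤ.- c) (nonneg-sum-pos _ _ _ im-pos
      (proj₁ f-floor) (proj₁ (proj₂ (u-floor 0))) sum₂))))
    where
    open ≡-Reasoning
    c : ℤ
    c = ((f ℤ.+ f) ℤ.+ trace D) ℤ.- + u 0
    w w′ F U T : K
    w = ω D
    w′ = conj w
    F = ιℤ f
    U = ιℤ (+ u 0)
    T = ιℤ (trace D)
    ιℤ-c : ιℤ c ≡ ((F ⊕ F) ⊕ T) ⊝ U
    ιℤ-c = trans (ιℤ-+ ((f ℤ.+ f) ℤ.+ trace D) (ℤ.- + u 0))
      (cong₂ _⊕_ (trans (ιℤ-+ (f ℤ.+ f) (trace D)) (cong (_⊕ T) (ιℤ-+ f f))) (ιℤ-neg (+ u 0)))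
    sum₁ : z 0 ⊕ (ιℤ (f ℤ.+ + 1) ⊝ (⊖ w′)) ≡ ιℤ (c ℤ.+ + 1)
    sum₁ = begin
      (γ 0 ⊝ U) ⊕ (ιℤ (f ℤ.+ + 1) ⊝ (⊖ w′))
        ≡⟨ cong₂ (λ g F+1 → (g ⊝ U) ⊕ (F+1 ⊝ (⊖ w′))) γ₀ (ιℤ-+ f (+ 1)) ⟩
      ((w ⊕ F) ⊝ U) ⊕ ((F ⊕ 1K) ⊝ (⊖ w′))
        ≡⟨ solve 4 (λ w w′ F U → ((w :+ F) :- U) :+ ((F :+ con (+ 1)) :- (:- w′))
                                   := (((F :+ F) :+ (w :+ w′)) :- U) :+ con (+ 1)) refl w w′ F U ⟩
      (((F ⊕ F) ⊕ (w ⊕ w′)) ⊝ U) ⊕ 1K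
        ≡⟨ cong (λ t → (((F ⊕ F) ⊕ t) ⊝ U) ⊕ 1K) (ω-trace D) ⟩
      (((F ⊕ F) ⊕ T) ⊝ U) ⊕ 1K            ≡⟨ cong (_⊕ 1K) ιℤ-c ⟨
      ιℤ c ⊕ 1K                           ≡⟨ ιℤ-+ c (+ 1) ⟨
      ιℤ (c ℤ.+ + 1)                      ∎
    im-pos : 0ℚ < im ((⊖ w′) ⊝ F)
    im-pos = subst (0ℚ <_) (sym (trans (ℚP.+-identityʳ _) (neg-neg _))) (ω-im-pos D)
    sum₂ : ((⊖ w′) ⊝ F) ⊕ (ιℤ (+ u 0 ℤ.+ + 1) ⊝ γ 0) ≡ ιℤ (+ 1 ℤ.- c)
    sum₂ = begin
      ((⊖ w′) ⊝ F) ⊕ (ιℤ (+ u 0 ℤ.+ + 1) ⊝ γ 0)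
        ≡⟨ cong₂ (λ U+1 g → ((⊖ w′) ⊝ F) ⊕ (U+1 ⊝ g)) (ιℤ-+ (+ u 0) (+ 1)) γ₀ ⟩
      ((⊖ w′) ⊝ F) ⊕ ((U ⊕ 1K) ⊝ (w ⊕ F))
        ≡⟨ solve 4 (λ w w′ F U → ((:- w′) :- F) :+ ((U :+ con (+ 1)) :- (w :+ F))
                                   := con (+ 1) :+ (:- (((F :+ F) :+ (w :+ w′)) :- U))) refl w w′ F U ⟩
      1K ⊕ (⊖ (((F ⊕ F) ⊕ (w ⊕ w′)) ⊝ U))
        ≡⟨ cong (λ t → 1K ⊕ (⊖ (((F ⊕ F) ⊕ t) ⊝ U))) (ω-trace D) ⟩
      1K ⊕ (⊖ (((F ⊕ F) ⊕ T) ⊝ U))         ≡⟨ cong (λ t → 1K ⊕ (⊖ t)) ιℤ-c ⟨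
      1K ⊕ (⊖ ιℤ c)                         ≡⟨ cong (1K ⊕_) (ιℤ-neg c) ⟨
      1K ⊕ ιℤ (ℤ.- c)                       ≡⟨ ιℤ-+ (+ 1) (ℤ.- c) ⟨
      ιℤ (+ 1 ℤ.- c)                        ∎

  p₀-eq : pS u 1 ≡ + u 0 ℤ.- f
  p₀-eq = ceil-half D (u 0) f u₀-eq

  α-rec : ∀ j → α (suc (suc j)) ≡ ιℕ (u (suc j)) · α (suc j) ⊕ α j
  α-rec j = begin
    ιℤ (Û ℤ.* p₁ ℤ.+ p₀) ⊝ ιℤ (Û ℤ.* q₁ ℤ.+ q₀) · w′
      ≡⟨ cong₂ (λ p q → p ⊝ q · w′) (expand p₁ p₀) (expand q₁ q₀) ⟩
    (ιℤ Û · ιℤ p₁ ⊕ ιℤ p₀) ⊝ (ιℤ Û · ιℤ q₁ ⊕ ιℤ q₀) · w′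
      ≡⟨ solve 6 (λ U P₁ P₀ Q₁ Q₀ w′ → (U :* P₁ :+ P₀) :- (U :* Q₁ :+ Q₀) :* w′
                                        := U :* (P₁ :- Q₁ :* w′) :+ (P₀ :- Q₀ :* w′))
           refl (ιℤ Û) (ιℤ p₁) (ιℤ p₀) (ιℤ q₁) (ιℤ q₀) w′ ⟩
    ιℤ Û · (ιℤ p₁ ⊝ ιℤ q₁ · w′) ⊕ (ιℤ p₀ ⊝ ιℤ q₀ · w′)  ∎
    where
    open ≡-Reasoning
    Û p₁ p₀ q₁ q₀ : ℤ
    Û = + u (suc j)
    p₁ = pS u (suc j)
    p₀ = pS u j
    q₁ = qS u (suc j)
    q₀ = qS u j
    w′ : K
    w′ = conj (ω D)
    expand : ∀ a b → ιℤ (Û ℤ.* a ℤ.+ b) ≡ ιℤ Û · ιℤ a ⊕ ιℤ b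
    expand a b = trans (ιℤ-+ (Û ℤ.* a) b) (cong (_⊕ ιℤ b) (ιℤ-* Û a))

  α-step : ∀ j → α (suc j) ≡ ⊖ (conj (z j) · α j)
  α-step zero = begin
    ιℤ (pS u 1) ⊝ 1K · w′              ≡⟨ cong (λ p → ιℤ p ⊝ 1K · w′) p₀-eq ⟩
    ιℤ (+ u 0 ℤ.- f) ⊝ 1K · w′         ≡⟨ cong (λ p → p ⊝ 1K · w′)
                                            (trans (ιℤ-+ (+ u 0) (ℤ.- f)) (cong (U ⊕_) (ιℤ-neg f))) ⟩
    (U ⊝ F) ⊝ 1K · w′                  ≡⟨ solve 3 (λ w′ F U → (U :- F) :- con (+ 1) :* w′
                                              := :- (((w′ :+ F) :- U) :* (con (+ 1) :- con (+ 0) :* w′)))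
                                            refl w′ F U ⟩
    ⊖ (((w′ ⊕ F) ⊝ U) · α 0)           ≡⟨ cong (λ y → ⊖ (y · α 0)) conj-z₀ ⟨
    ⊖ (conj (z 0) · α 0)               ∎
    where
    open ≡-Reasoning
    w′ F U : K
    w′ = conj (ω D)
    F = ιℤ f
    U = ιℤ (+ u 0)
    conj-z₀ : conj (z 0) ≡ (w′ ⊕ F) ⊝ U
    conj-z₀ = trans (cong (λ g → conj (g ⊝ U)) γ₀)
                    (trans (conj-⊕ (ω D ⊕ F) (⊖ U)) (cong (_⊝ U) (conj-⊕ (ω D) F)))
  α-step (suc j) = begin
    α (suc (suc j))                          ≡⟨ α-rec j ⟩
    U · α (suc j) ⊕ α j                      ≡⟨ cong (U · α (suc j) ⊕_) α-back ⟩
    U · α (suc j) ⊕ (⊖ (conj g · α (suc j))) ≡⟨ solve 3 (λ U g′ B → U :* B :+ (:- (g′ :* B)) := :- ((g′ :- U) :* B))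
                                                 refl U (conj g) (α (suc j)) ⟩
    ⊖ ((conj g ⊝ U) · α (suc j))             ≡⟨ cong (λ y → ⊖ (y · α (suc j))) (conj-⊕ g (⊖ U)) ⟨
    ⊖ (conj (z (suc j)) · α (suc j))         ∎
    where
    open ≡-Reasoning
    U g : K
    U = ιℕ (u (suc j))
    g = γ (suc j)
    α-back : α j ≡ ⊖ (conj g · α (suc j))
    α-back = sym (trans (cong (λ y → ⊖ (conj g · y)) (α-step j))
                        (trans (cong (λ h → ⊖ (conj h · (⊖ (conj (z j) · α j)))) (γ-suc j))
                               (⊖conj-cancel (z j) (α j) (norm-z≢0 j))))

  -- cross j = α_{j−1}′ α_j − α_{j−1} α_j′ changes sign at each step and starts at
  -- ω − ω′ = √Δ; so it equals √Δ at even j.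
  cross : ℕ → K
  cross j = conj (α j) · α (suc j) ⊝ α j · conj (α (suc j))

  conj-α-rec : ∀ j → conj (α (suc (suc j))) ≡ ιℕ (u (suc j)) · conj (α (suc j)) ⊕ conj (α j)
  conj-α-rec j = trans (cong conj (α-rec j))
    (trans (conj-⊕ (ιℕ (u (suc j)) · α (suc j)) (α j)) (cong (_⊕ conj (α j)) (conj-· (ιℕ (u (suc j))) (α (suc j)))))

  cross-step : ∀ j → cross (suc j) ≡ ⊖ cross j
  cross-step j = begin
    conj B · α (suc (suc j)) ⊝ B · conj (α (suc (suc j)))
      ≡⟨ cong₂ (λ C C′ → conj B · C ⊝ B · C′) (α-rec j) (conj-α-rec j) ⟩
    conj B · (U · B ⊕ A) ⊝ B · (U · conj B ⊕ conj A)
      ≡⟨ solve 5 (λ U A A′ B B′ → B′ :* (U :* B :+ A) :- B :* (U :* B′ :+ A′) := :- (A′ :* B :- A :* B′))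
           refl U A (conj A) B (conj B) ⟩
    ⊖ cross j ∎
    where
    open ≡-Reasoning
    U A B : K
    U = ιℕ (u (suc j))
    A = α j
    B = α (suc j)

  cross-zero : cross 0 ≡ sqrtΔ D
  cross-zero = begin
    conj (α 0) · α 1 ⊝ α 0 · conj (α 1)
      ≡⟨ cong₂ (λ A′ B′ → A′ · α 1 ⊝ α 0 · B′) (conj-α 0) (conj-α 1) ⟩
    (1K ⊝ 0K · w) · (P ⊝ 1K · w′) ⊝ (1K ⊝ 0K · w′) · (P ⊝ 1K · w)
      ≡⟨ solve 3 (λ P w w′ → (con (+ 1) :- con (+ 0) :* w) :* (P :- con (+ 1) :* w′)
                             :- (con (+ 1) :- con (+ 0) :* w′) :* (P :- con (+ 1) :* w) := w :- w′)
           refl P w w′ ⟩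
    w ⊝ w′   ≡⟨ ω-diff D ⟩
    sqrtΔ D  ∎
    where
    open ≡-Reasoning
    P w w′ : K
    P = ιℤ (pS u 1)
    w = ω D
    w′ = conj w
    conj-α : ∀ j → conj (α j) ≡ ιℤ (pS u j) ⊝ ιℤ (qS u j) · w
    conj-α j = trans (conj-⊕ (ιℤ (pS u j)) (⊖ (ιℤ (qS u j) · w′)))
                     (cong (λ y → ιℤ (pS u j) ⊝ y) (trans (conj-· (ιℤ (qS u j)) w′) (cong (ιℤ (qS u j) ·_) (conj-conj w))))

  cross-even : ∀ k → cross (2 ℕ.* k) ≡ sqrtΔ D
  cross-even zero = cross-zero
  cross-even (suc k) = begin
    cross (2 ℕ.* suc k)            ≡⟨ cong cross (ℕP.*-suc 2 k) ⟩
    cross (suc (suc (2 ℕ.* k)))    ≡⟨ trans (cross-step (suc (2 ℕ.* k))) (cong ⊖_ (cross-step (2 ℕ.* k))) ⟩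
    ⊖ (⊖ cross (2 ℕ.* k))          ≡⟨ solve 1 (λ x → :- (:- x) := x) refl (cross (2 ℕ.* k)) ⟩
    cross (2 ℕ.* k)                ≡⟨ cross-even k ⟩
    sqrtΔ D                        ∎
    where open ≡-Reasoning

  -- N(α_j) = N(z_j) N(α_{j−1}) with N(z_j) < 0 and N(α_{−1}) = 1: the norms
  -- alternate in sign, and N(α_i) > 0 for odd i, i.e. N(α (2k)) > 0.
  norm-α-step : ∀ j → normK D (α (suc j)) ≡ normK D (z j) * normK D (α j)
  norm-α-step j = trans (cong (normK D) (α-step j)) (norm-⊖conj· (z j) (α j))

  norm-α-even-pos : ∀ k → 0ℚ < normK D (α (2 ℕ.* k))
  norm-α-even-pos zero = subst (0ℚ <_) (sym (trans (cong (normK D) α₀≡1) (norm-ι 1ℚ))) (ℚP.positive⁻¹ 1ℚ)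
    where
    α₀≡1 : α 0 ≡ 1K
    α₀≡1 = solve 1 (λ w′ → con (+ 1) :- con (+ 0) :* w′ := con (+ 1)) refl (conj (ω D))
  norm-α-even-pos (suc k) = subst (λ i → 0ℚ < normK D (α i)) (sym (ℕP.*-suc 2 k)) even-pos
    where
    j = 2 ℕ.* k
    odd-neg : normK D (α (suc j)) < 0ℚ
    odd-neg = subst (_< 0ℚ) (sym (norm-α-step j)) (neg*pos<0 (norm-z-neg j) (norm-α-even-pos k))
    even-pos : 0ℚ < normK D (α (suc (suc j)))
    even-pos = subst (0ℚ <_) (sym (norm-α-step (suc j))) (neg*neg>0 (norm-z-neg (suc j)) odd-neg)

-- Lemma 5.2.  For odd i = 2k − 1 put A = α_i, B = α_{i+1}, z = z_{i+1}.  Then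
-- B = −z′A, γ_{i+2}⁻¹ = z, A′B − AB′ = √Δ and N_i = N(A) > 0, so the identity
-- is an instance of norm-form.
lemma5p2 : (D : ℕ) → 2 ℕ.≤ D → SquareFree D →
    (f : ℤ) → IsFloor D f (⊖ conj (ω D)) →
    (u : ℕ → ℕ) → (γ : ℕ → K) →
    γ 0 ≡ σ D f →
    (∀ k → IsFloor D (ℤ.+ u k) (γ k)) →
    (∀ k → γ (ℕ.suc k) ≡ invK D (γ k ⊝ ιℕ (u k))) →
    (k : ℕ) → (m n : ℤ) →
      ι (normK D (mulK D (ιℤ m) (αS D u (2 ℕ.* k)) ⊕ mulK D (ιℤ n) (αS D u (ℕ.suc (2 ℕ.* k)))))
      ≡ mulK D
          (ιℤ m ⊝ mulK D (ιℤ n) (invK D (γ (ℕ.suc (2 ℕ.* k)))))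
          ((mulK D (ιℤ n) (sqrtΔ D) ⊕ mulK D (ιℤ m) (ι (NS D u (2 ℕ.* k))))
            ⊝ mulK D (ιℤ n) (mulK D (ι (NS D u (2 ℕ.* k))) (invK D (γ (ℕ.suc (2 ℕ.* k))))))
lemma5p2 D 2≤D sf f f-floor u γ γ₀ u-floor γ-suc k m n =
  norm-form m n (α j) (α (suc j)) (z j) _ _ _ (α-step j) inverse-z (sym (cross-even k)) N-pos
  where
  open KArithmetic D using (norm-form; invK-involutive)
  open Expansion D 2≤D sf f f-floor u γ γ₀ u-floor γ-suc
  j : ℕ
  j = 2 ℕ.* k
  inverse-z : invK D (γ (suc j)) ≡ z j
  inverse-z = trans (cong (invK D) (γ-suc j)) (invK-involutive (z j) (norm-z≢0 j))
  N-pos : NS D u j ≡ normK D (α j)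
  N-pos = ℚP.0≤p⇒∣p∣≡p (ℚP.<⇒≤ (norm-α-even-pos k))
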